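{- Let $k\ge2$ and let $a_1\ge a_2\ge\cdots\ge a_k$ be positive integers. Let \[G(x,y)=\sum_\lambda x^{\lambda_1+\lambda_3+\lambda_5+\cdots}y^{\lambda_2+\lambda_4+\cdots},\] the sum over all integer sequences $(\lambda_1,\ldots,\lambda_k)$ with $\lambda_1/a_1\ge\lambda_2/a_2\ge\cdots\ge\lambda_k/a_k\ge0$, and define $H(x,y)=(1-x)G(x,y)$. Then for all integers $l>0$ and $j\ge2-l$, $H(x^l,x^{j-1}y)$ equals $\sum_\lambda x^{\lambda_1+\lambda_3+\cdots}y^{\lambda_2+\lambda_4+\cdots}$ summed over the integer sequences $(\lambda_1,\ldots,\lambda_k)$ satisfying \[\lambda_1=l\left\lceil\frac{a_1\lambda_2}{a_2}\right\rceil+\sum_{i\ge1}\big((j-1)\lambda_{2i}+(l-1)\lambda_{2i+1}\big),\qquad \frac{\lambda_2}{a_2}\ge\frac{\lambda_3}{a_3}\ge\cdots\ge\frac{\lambda_k}{a_k}\ge0,\] where $\lambda_m=0$ for $m>k$. -}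

module Defs where

open import Data.Nat using (ℕ; zero; suc; _+_; _*_; _≤ᵇ_; _≡ᵇ_; _/_)
open import Data.Integer as ℤ using (ℤ; +_)
open import Data.Bool using (Bool; true; false; _∧_; if_then_else_)
open import Data.Vec using (Vec; []; _∷_)
open import Data.List using (List; []; _∷_; _++_; map; concatMap; upTo)
open import Relation.Nullary.Decidable using (⌊_⌋)

_==ℤ_ : ℤ → ℤ → Bool
x ==ℤ y = ⌊ x ℤ.≟ y ⌋

-- Ceiling division ⌈ n / d ⌉ (only used with d ≥ 1; value for d = 0 irrelevant).
ceilDiv : ℕ → ℕ → ℕ
ceilDiv n zero    = 0
ceilDiv n (suc d) = (n + d) / suc d

-- ratioOK a λ  ⇔  λ₁/a₁ ≥ λ₂/a₂ ≥ ⋯ ≥ λₙ/aₙ  (all aᵢ > 0, comparisons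
-- cross-multiplied: x/a ≥ y/b ⇔ y·a ≤ x·b).  "≥ 0" is automatic in ℕ.
ratioOK : ∀ {n} → Vec ℕ n → Vec ℕ n → Bool
ratioOK (a ∷ b ∷ as) (x ∷ y ∷ xs) = ((y * a) ≤ᵇ (x * b)) ∧ ratioOK (b ∷ as) (y ∷ xs)
ratioOK _ _ = true

-- sumOdd (λ₁,λ₂,…) = λ₁ + λ₃ + λ₅ + ⋯ ;  sumEven (λ₁,λ₂,…) = λ₂ + λ₄ + ⋯
sumOdd  : ∀ {n} → Vec ℕ n → ℕ
sumEven : ∀ {n} → Vec ℕ n → ℕ
sumOdd  []       = 0
sumOdd  (x ∷ xs) = x + sumEven xs
sumEven []       = 0
sumEven (x ∷ xs) = sumOdd xs

vecsUpTo : (n N : ℕ) → List (Vec ℕ n)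
vecsUpTo zero    N = [] ∷ []
vecsUpTo (suc n) N = concatMap (λ x → map (x ∷_) (vecsUpTo n N)) (upTo (suc N))

countB : ∀ {A : Set} → (A → Bool) → List A → ℕ
countB P []       = 0
countB P (x ∷ xs) = (if P x then 1 else 0) + countB P xs

-- Coefficient of x^A y^B in G(x,y): number of λ ∈ ℕ^k with
-- λ₁/a₁ ≥ ⋯ ≥ λₖ/aₖ ≥ 0, λ₁+λ₃+⋯ = A, λ₂+λ₄+⋯ = B.
-- (Every such λ has all entries ≤ A + B, so enumerating vecsUpTo k (A+B) is exhaustive.)
gCoeff : ∀ {k} → Vec ℕ k → ℕ → ℕ → ℕ
gCoeff {k} a A B =
  countB (λ lam → ratioOK a lam ∧ (sumOdd lam ≡ᵇ A) ∧ (sumEven lam ≡ᵇ B))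
         (vecsUpTo k (A + B))

-- Coefficient of x^A y^B in H(x,y) = (1 - x) G(x,y).
hCoeff : ∀ {k} → Vec ℕ k → ℕ → ℕ → ℤ
hCoeff a zero    B = + gCoeff a zero B
hCoeff a (suc A) B = + gCoeff a (suc A) B ℤ.- + gCoeff a A B

sumTo : ℕ → (ℕ → ℤ) → ℤ
sumTo zero    f = f 0
sumTo (suc N) f = sumTo N f ℤ.+ f (suc N)

-- Coefficient of x^p y^q (p ∈ ℤ, q ∈ ℕ) in H(x^l, x^(j-1) y)
--   = Σ_{A,B} h_{A,B} x^(lA + (j-1)B) y^B,
-- i.e. the sum of h_{A,q} over all A ∈ ℕ with l·A + (j-1)·q = p.
-- Since l ≥ 1, such A satisfy A ≤ |p - (j-1)q|, so the bounded sum is exhaustive.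
lhsCoeff : ∀ {k} → Vec ℕ k → (l : ℕ) → (j p : ℤ) → (q : ℕ) → ℤ
lhsCoeff a l j p q =
  sumTo (ℤ.∣ p ℤ.- (j ℤ.- + 1) ℤ.* + q ∣)
        (λ A → if (+ (l * A) ℤ.+ (j ℤ.- + 1) ℤ.* + q) ==ℤ p then hCoeff a A q else + 0)

-- Σ_{i≥1} ((j-1) λ_{2i} + (l-1) λ_{2i+1}) written on the tail (λ₂,λ₃,…,λₖ):
-- alternately weight c, d, c, d, … starting with c = j-1, d = l-1.
sumAlt : ∀ {n} → ℤ → ℤ → Vec ℕ n → ℤ
sumAlt c d []       = + 0
sumAlt c d (x ∷ xs) = c ℤ.* + x ℤ.+ sumAlt d c xs

lambda1 : ∀ {n} → ℕ → Vec ℕ n → (l : ℕ) → (j : ℤ) → Vec ℕ n → ℤ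
lambda1 a1 (a2 ∷ as) l j (t2 ∷ ts) =
  + (l * ceilDiv (a1 * t2) a2) ℤ.+ sumAlt (j ℤ.- + 1) (+ l ℤ.- + 1) (t2 ∷ ts)
lambda1 a1 _ l j _ = + 0

-- Coefficient of x^p y^q in Σ_λ x^(λ₁+λ₃+⋯) y^(λ₂+λ₄+⋯) over the integer
-- sequences λ with λ₁ given by lambda1 and λ₂/a₂ ≥ ⋯ ≥ λₖ/aₖ ≥ 0.
-- Such λ are determined by the tail τ = (λ₂,…,λₖ) ∈ ℕ^(k-1); then
-- λ₁+λ₃+⋯ = λ₁ + sumEven τ and λ₂+λ₄+⋯ = sumOdd τ.  Tail entries are ≤ λ₂ ≤ q
-- (as a₂ ≥ aᵢ), so enumerating vecsUpTo (k-1) q is exhaustive.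
rhsCoeff : ∀ {k} → Vec ℕ k → (l : ℕ) → (j p : ℤ) → (q : ℕ) → ℕ
rhsCoeff [] l j p q = 0
rhsCoeff {suc m} (a1 ∷ as) l j p q =
  countB (λ τ → ratioOK as τ
               ∧ ((lambda1 a1 as l j τ ℤ.+ + sumEven τ) ==ℤ p)
               ∧ (sumOdd τ ≡ᵇ q))
         (vecsUpTo m q)

module Submission where

open import Defs
open import Data.Nat using (ℕ; _≤_; _<_)
open import Data.Integer as ℤ using (ℤ; +_)
open import Data.Fin as Fin using (Fin)
open import Data.Vec using (Vec; lookup)
open import Relation.Binary.PropositionalEquality using (_≡_)

open import Algebra.Bundles using (CommutativeMonoid)
open import Algebra.Properties.CommutativeSemigroup using (interchange)
open import Data.Bool using (Bool; true; false; _∧_; if_then_else_; T)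
open import Data.Bool.Properties using (∧-comm; ∧-identityʳ; ∧-zeroʳ; ∧-commutativeMonoid; T-∧)
open import Data.Empty using (⊥-elim)
open import Data.Integer.Properties using (pos-+; pos-*; [+m]-[+n]≡m⊖n; ⊖-≥)
open import Data.Integer.Solver using (module +-*-Solver)
open import Data.List using (List; []; _∷_; _++_; map; concatMap; applyUpTo)
open import Data.Nat using (zero; suc; _+_; _*_; _∸_; _≤ᵇ_; _≡ᵇ_; _/_; _%_; z≤n; s≤s; NonZero; >-nonZero; _<?_)
import Data.Nat.DivMod as ℕ
import Data.Nat.Properties as ℕ
open import Data.Product using (_×_; _,_; proj₁; proj₂)
open import Data.Unit using (tt)
open import Data.Vec using ([]; _∷_; head)
open import Data.Vec.Relation.Unary.All as All using (All; []; _∷_)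
open import Function using (_∘_; _⇔_; mk⇔; Equivalence)
open import Relation.Binary.PropositionalEquality using (_≢_; refl; sym; trans; cong; cong₂; subst; module ≡-Reasoning)
open import Relation.Nullary using (¬_; yes; no)
open import Relation.Nullary.Decidable using (toWitness)

-- Write λ = (λ₁, τ) with tail τ = (λ₂, …, λₖ).  For a fixed admissible tail the
-- admissible heads are exactly λ₁ ≥ ⌈a₁λ₂/a₂⌉, so the x-exponents λ₁ + λ₃ + ⋯ of the
-- sequences with tail τ run through E(τ), E(τ) + 1, …, where E(τ) = ⌈a₁λ₂/a₂⌉ + λ₃ + λ₅ + ⋯.
-- Hence the coefficient of x^A y^q in G counts the tails with E(τ) ≤ A, and multiplying by
-- 1 − x leaves those with E(τ) = A: H(x, y) = Σ_τ x^E(τ) y^(λ₂+λ₄+⋯).  Substituting x^l for x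
-- and x^(j−1) y for y turns the exponent of x into l E(τ) + (j − 1)(λ₂ + λ₄ + ⋯), and this is
-- λ₁ + λ₃ + ⋯ for the λ₁ prescribed on the right-hand side.

ind : Bool → ℕ
ind b = if b then 1 else 0

ind-¬T : ∀ {b} → ¬ T b → ind b ≡ 0
ind-¬T {false} _  = refl
ind-¬T {true}  ¬t = ⊥-elim (¬t tt)

T-injective : ∀ {b c} → (T b → T c) → (T c → T b) → b ≡ c
T-injective {false} {false} _ _ = refl
T-injective {false} {true}  _ g = ⊥-elim (g tt)
T-injective {true}  {false} f _ = ⊥-elim (f tt)
T-injective {true}  {true}  _ _ = refl

T-split : ∀ {b c} → T (b ∧ c) → T b × T c
T-split = Equivalence.to T-∧

≡ᵇ-refl : ∀ n → (n ≡ᵇ n) ≡ true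
≡ᵇ-refl n = T-injective (λ _ → tt) (λ _ → ℕ.≡⇒≡ᵇ n n refl)

∧-interchange : ∀ a b c d → (a ∧ b) ∧ (c ∧ d) ≡ (a ∧ c) ∧ (b ∧ d)
∧-interchange = interchange (CommutativeMonoid.commutativeSemigroup ∧-commutativeMonoid)

ind-≤ᵇ-suc : ∀ e A → ind (e ≤ᵇ suc A) ≡ ind (e ≤ᵇ A) + ind (e ≡ᵇ suc A)
ind-≤ᵇ-suc zero          A       = refl
ind-≤ᵇ-suc (suc zero)    zero    = refl
ind-≤ᵇ-suc (suc (suc e)) zero    = refl
ind-≤ᵇ-suc (suc zero)    (suc A) = refl
ind-≤ᵇ-suc (suc (suc e)) (suc A) = ind-≤ᵇ-suc (suc e) A

[r∧o]∧c≡r∧[c′∧o] : ∀ r o {c c′} → (T o → c ≡ c′) → (r ∧ o) ∧ c ≡ r ∧ (c′ ∧ o)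
[r∧o]∧c≡r∧[c′∧o] false o                 _    = refl
[r∧o]∧c≡r∧[c′∧o] true  false {c′ = c′} _    = sym (∧-zeroʳ c′)
[r∧o]∧c≡r∧[c′∧o] true  true  {c′ = c′} c≡c′ = trans (c≡c′ tt) (sym (∧-identityʳ c′))

≤ᵇ0≡≡ᵇ0 : ∀ e → (e ≤ᵇ 0) ≡ (e ≡ᵇ 0)
≤ᵇ0≡≡ᵇ0 zero    = refl
≤ᵇ0≡≡ᵇ0 (suc e) = refl

[c≤A∸s]∧[A∸s+s≡A]≡[c+s≤A] : ∀ c s A → ((c ≤ᵇ A ∸ s) ∧ (A ∸ s + s ≡ᵇ A)) ≡ (c + s ≤ᵇ A)
[c≤A∸s]∧[A∸s+s≡A]≡[c+s≤A] c s A = T-injective to from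
  where
  to : T ((c ≤ᵇ A ∸ s) ∧ (A ∸ s + s ≡ᵇ A)) → T (c + s ≤ᵇ A)
  to h with T-split h
  ... | c≤A∸s , eq = ℕ.≤⇒≤ᵇ (subst (c + s ≤_) (ℕ.≡ᵇ⇒≡ _ _ eq) (ℕ.+-monoˡ-≤ s (ℕ.≤ᵇ⇒≤ _ _ c≤A∸s)))
  from : T (c + s ≤ᵇ A) → T ((c ≤ᵇ A ∸ s) ∧ (A ∸ s + s ≡ᵇ A))
  from h = Equivalence.from T-∧
    ( ℕ.≤⇒≤ᵇ (subst (_≤ A ∸ s) (ℕ.m+n∸n≡m c s) (ℕ.∸-monoˡ-≤ s c+s≤A))
    , ℕ.≡⇒≡ᵇ _ _ (ℕ.m∸n+n≡m (ℕ.≤-trans (ℕ.m≤n+m s c) c+s≤A)) )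
    where
    c+s≤A : c + s ≤ A
    c+s≤A = ℕ.≤ᵇ⇒≤ _ _ h

sumBelow : ℕ → (ℕ → ℕ) → ℕ
sumBelow zero    f = 0
sumBelow (suc n) f = f 0 + sumBelow n (f ∘ suc)

sumBelow-cong : ∀ n {f g} → (∀ x → f x ≡ g x) → sumBelow n f ≡ sumBelow n g
sumBelow-cong zero    e = refl
sumBelow-cong (suc n) e = cong₂ _+_ (e 0) (sumBelow-cong n (e ∘ suc))

sumBelow-zero : ∀ n {f} → (∀ x → x < n → f x ≡ 0) → sumBelow n f ≡ 0
sumBelow-zero zero    e = refl
sumBelow-zero (suc n) e = cong₂ _+_ (e 0 (s≤s z≤n)) (sumBelow-zero n (λ x x<n → e (suc x) (s≤s x<n)))

sumBelow-suc : ∀ n f → sumBelow (suc n) f ≡ sumBelow n f + f n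
sumBelow-suc zero    f = ℕ.+-comm (f 0) 0
sumBelow-suc (suc n) f = trans (cong (_+_ (f 0)) (sumBelow-suc n (f ∘ suc))) (sym (ℕ.+-assoc (f 0) _ _))

sumBelow-+ : ∀ n f g → sumBelow n (λ x → f x + g x) ≡ sumBelow n f + sumBelow n g
sumBelow-+ zero    f g = refl
sumBelow-+ (suc n) f g = trans (cong (_+_ (f 0 + g 0)) (sumBelow-+ n (f ∘ suc) (g ∘ suc)))
                               (interchange ℕ.+-commutativeSemigroup (f 0) (g 0) _ _)

sumBelow-truncate : ∀ {m n f} → m ≤ n → (∀ x → m ≤ x → f x ≡ 0) → sumBelow n f ≡ sumBelow m f
sumBelow-truncate {zero}  {n}     _         e = sumBelow-zero n (λ x _ → e x z≤n)
sumBelow-truncate {suc m} {suc n} {f} (s≤s m≤n) e =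
  cong (_+_ (f 0)) (sumBelow-truncate m≤n (λ x m≤x → e (suc x) (s≤s m≤x)))

sumBelow-single : ∀ n {f} t → t < n → (∀ x → x ≢ t → f x ≡ 0) → sumBelow n f ≡ f t
sumBelow-single (suc n) {f} zero    _         e =
  trans (cong (_+_ (f 0)) (sumBelow-zero n (λ x _ → e (suc x) (λ ())))) (ℕ.+-identityʳ (f 0))
sumBelow-single (suc n)     (suc t) (s≤s t<n) e =
  cong₂ _+_ (e 0 (λ ())) (sumBelow-single n t t<n (λ x x≢t → e (suc x) (x≢t ∘ ℕ.suc-injective)))

sumBelow-indicator : ∀ n (P : ℕ → Bool) t → (∀ x → T (P x) → x ≡ t) → (T (P t) → t < n) →
                     sumBelow n (ind ∘ P) ≡ ind (P t)
sumBelow-indicator n P t unique range with t <? n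
... | yes t<n = sumBelow-single n t t<n (λ x x≢t → ind-¬T (x≢t ∘ unique x))
... | no  t≮n = trans (sumBelow-zero n (λ x x<n → ind-¬T (λ Px → t≮n (subst (_< n) (unique x Px) x<n))))
                      (sym (ind-¬T (t≮n ∘ range)))

sumBelow-[c≤x∧x+s≡A] : ∀ n c s A → A < n → (b : Bool) →
  sumBelow n (λ x → ind (b ∧ ((c ≤ᵇ x) ∧ (x + s ≡ᵇ A)))) ≡ ind (b ∧ (c + s ≤ᵇ A))
sumBelow-[c≤x∧x+s≡A] n c s A A<n b =
  trans (sumBelow-indicator n _ (A ∸ s) solution (λ _ → ℕ.≤-<-trans (ℕ.m∸n≤m A s) A<n))
        (cong (λ z → ind (b ∧ z)) ([c≤A∸s]∧[A∸s+s≡A]≡[c+s≤A] c s A))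
  where
  solution : ∀ x → T (b ∧ ((c ≤ᵇ x) ∧ (x + s ≡ᵇ A))) → x ≡ A ∸ s
  solution x h = trans (sym (ℕ.m+n∸n≡m x s))
                       (cong (_∸ s) (ℕ.≡ᵇ⇒≡ _ _ (proj₂ (T-split (proj₂ (T-split {b} h))))))

module _ {A : Set} where

  countB-++ : ∀ P (xs ys : List A) → countB P (xs ++ ys) ≡ countB P xs + countB P ys
  countB-++ P []       ys = refl
  countB-++ P (x ∷ xs) ys = trans (cong (_+_ (ind (P x))) (countB-++ P xs ys)) (sym (ℕ.+-assoc (ind (P x)) _ _))

  countB-cong : ∀ {P Q} (xs : List A) → (∀ x → P x ≡ Q x) → countB P xs ≡ countB Q xs
  countB-cong []       e = refl
  countB-cong (x ∷ xs) e = cong₂ (λ b r → ind b + r) (e x) (countB-cong xs e)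

  countB-none : ∀ {P} (xs : List A) → (∀ x → ¬ T (P x)) → countB P xs ≡ 0
  countB-none []       _ = refl
  countB-none (x ∷ xs) h = cong₂ _+_ (ind-¬T (h x)) (countB-none xs h)

  countB-+ : ∀ {P Q R} (xs : List A) → (∀ x → ind (P x) ≡ ind (Q x) + ind (R x)) →
             countB P xs ≡ countB Q xs + countB R xs
  countB-+ []       e = refl
  countB-+ {P} {Q} {R} (x ∷ xs) e =
    trans (cong₂ _+_ (e x) (countB-+ xs e))
          (interchange ℕ.+-commutativeSemigroup (ind (Q x)) (ind (R x)) (countB Q xs) (countB R xs))

  sumBelow-countB : ∀ n (Q : ℕ → A → Bool) (R : A → Bool) (xs : List A) →
                    (∀ y → sumBelow n (λ x → ind (Q x y)) ≡ ind (R y)) →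
                    sumBelow n (λ x → countB (Q x) xs) ≡ countB R xs
  sumBelow-countB n Q R []       e = sumBelow-zero n (λ _ _ → refl)
  sumBelow-countB n Q R (y ∷ xs) e =
    trans (sumBelow-+ n (λ x → ind (Q x y)) (λ x → countB (Q x) xs))
          (cong₂ _+_ (e y) (sumBelow-countB n Q R xs e))

countB-map : ∀ {A B : Set} (P : B → Bool) (f : A → B) xs → countB P (map f xs) ≡ countB (P ∘ f) xs
countB-map P f []       = refl
countB-map P f (x ∷ xs) = cong (_+_ (ind (P (f x)))) (countB-map P f xs)

countB-concatMap-∷ : ∀ {n} (P : Vec ℕ (suc n) → Bool) (L : List (Vec ℕ n)) g m →
  countB P (concatMap (λ x → map (x ∷_) L) (applyUpTo g m)) ≡ sumBelow m (λ i → countB (λ τ → P (g i ∷ τ)) L)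
countB-concatMap-∷ P L g zero    = refl
countB-concatMap-∷ P L g (suc m) =
  trans (countB-++ P (map (g 0 ∷_) L) _)
        (cong₂ _+_ (countB-map P (g 0 ∷_) L) (countB-concatMap-∷ P L (g ∘ suc) m))

countB-vecsUpTo-suc : ∀ {n} (P : Vec ℕ (suc n) → Bool) N →
  countB P (vecsUpTo (suc n) N) ≡ sumBelow (suc N) (λ x → countB (λ τ → P (x ∷ τ)) (vecsUpTo n N))
countB-vecsUpTo-suc {n} P N = countB-concatMap-∷ P (vecsUpTo n N) (λ x → x) (suc N)

countB-vecsUpTo-≤ : ∀ n {M N} (P : Vec ℕ n → Bool) → M ≤ N → (∀ τ → T (P τ) → All (_≤ M) τ) →
                    countB P (vecsUpTo n N) ≡ countB P (vecsUpTo n M)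
countB-vecsUpTo-≤ zero    P M≤N bounded = refl
countB-vecsUpTo-≤ (suc n) {M} {N} P M≤N bounded = begin
  countB P (vecsUpTo (suc n) N)                                ≡⟨ countB-vecsUpTo-suc P N ⟩
  sumBelow (suc N) (λ x → countB (P ∘ (x ∷_)) (vecsUpTo n N))  ≡⟨ sumBelow-truncate (s≤s M≤N) head>M ⟩
  sumBelow (suc M) (λ x → countB (P ∘ (x ∷_)) (vecsUpTo n N))  ≡⟨ sumBelow-cong (suc M) shrink-tail ⟩
  sumBelow (suc M) (λ x → countB (P ∘ (x ∷_)) (vecsUpTo n M))  ≡⟨ countB-vecsUpTo-suc P M ⟨
  countB P (vecsUpTo (suc n) M)                                ∎
  where
  open ≡-Reasoning
  head>M : ∀ x → suc M ≤ x → countB (P ∘ (x ∷_)) (vecsUpTo n N) ≡ 0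
  head>M x M<x = countB-none (vecsUpTo n N) λ τ Pxτ → ℕ.<⇒≱ M<x (All.head (bounded (x ∷ τ) Pxτ))
  shrink-tail : ∀ x → countB (P ∘ (x ∷_)) (vecsUpTo n N) ≡ countB (P ∘ (x ∷_)) (vecsUpTo n M)
  shrink-tail x = countB-vecsUpTo-≤ n (P ∘ (x ∷_)) M≤N (λ τ Pxτ → All.tail (bounded (x ∷ τ) Pxτ))

sumTo-cong : ∀ D {f g : ℕ → ℤ} → (∀ A → f A ≡ g A) → sumTo D f ≡ sumTo D g
sumTo-cong zero    eq = eq 0
sumTo-cong (suc D) eq = cong₂ ℤ._+_ (sumTo-cong D eq) (eq (suc D))

sumTo-pos : ∀ D f → sumTo D (+_ ∘ f) ≡ + sumBelow (suc D) f
sumTo-pos zero    f = cong +_ (sym (ℕ.+-identityʳ (f 0)))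
sumTo-pos (suc D) f = begin
  sumTo D (+_ ∘ f) ℤ.+ + f (suc D)      ≡⟨ cong (ℤ._+ + f (suc D)) (sumTo-pos D f) ⟩
  + sumBelow (suc D) f ℤ.+ + f (suc D)  ≡⟨ pos-+ (sumBelow (suc D) f) (f (suc D)) ⟨
  + (sumBelow (suc D) f + f (suc D))    ≡⟨ cong +_ (sumBelow-suc (suc D) f) ⟨
  + sumBelow (suc (suc D)) f            ∎
  where open ≡-Reasoning

if-countB : ∀ {A : Set} c (P : A → Bool) xs → (if c then + countB P xs else + 0) ≡ + countB (λ x → c ∧ P x) xs
if-countB true  P xs = refl
if-countB false P xs = cong +_ (sym (countB-none xs (λ _ ())))

sumTo-fibres : ∀ {X : Set} (e : X → ℕ) (cnd : ℕ → Bool) D → (∀ A → T (cnd A) → A ≤ D) →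
  ∀ (b : X → Bool) xs →
  sumTo D (λ A → if cnd A then + countB (λ x → b x ∧ (e x ≡ᵇ A)) xs else + 0) ≡ + countB (λ x → b x ∧ cnd (e x)) xs
sumTo-fibres {X} e cnd D cnd⇒≤D b xs = begin
  sumTo D (λ A → if cnd A then + countB (λ x → b x ∧ (e x ≡ᵇ A)) xs else + 0)
    ≡⟨ sumTo-cong D (λ A → if-countB (cnd A) _ xs) ⟩
  sumTo D (λ A → + countB (fibre A) xs)              ≡⟨ sumTo-pos D (λ A → countB (fibre A) xs) ⟩
  + sumBelow (suc D) (λ A → countB (fibre A) xs)     ≡⟨ cong +_ (sumBelow-countB (suc D) fibre _ xs fibre-count) ⟩
  + countB (λ x → b x ∧ cnd (e x)) xs                ∎
  where
  open ≡-Reasoning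
  fibre : ℕ → X → Bool
  fibre A x = cnd A ∧ (b x ∧ (e x ≡ᵇ A))
  fibre-count : ∀ x → sumBelow (suc D) (λ A → ind (fibre A x)) ≡ ind (b x ∧ cnd (e x))
  fibre-count x = trans (sumBelow-indicator (suc D) (λ A → fibre A x) (e x) on-fibre (s≤s ∘ cnd⇒≤D (e x) ∘ proj₁ ∘ T-split))
    (cong ind (begin
      cnd (e x) ∧ (b x ∧ (e x ≡ᵇ e x)) ≡⟨ cong (λ z → cnd (e x) ∧ (b x ∧ z)) (≡ᵇ-refl (e x)) ⟩
      cnd (e x) ∧ (b x ∧ true)          ≡⟨ cong (cnd (e x) ∧_) (∧-identityʳ (b x)) ⟩
      cnd (e x) ∧ b x                   ≡⟨ ∧-comm (cnd (e x)) (b x) ⟩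
      b x ∧ cnd (e x)                   ∎))
    where
    on-fibre : ∀ A → T (fibre A x) → A ≡ e x
    on-fibre A h = sym (ℕ.≡ᵇ⇒≡ _ _ (proj₂ (T-split {b x} (proj₂ (T-split {cnd A} h)))))

ceilDiv-≤⇔ : ∀ n {a} x → 0 < a → ceilDiv n a ≤ x ⇔ n ≤ x * a
ceilDiv-≤⇔ n {suc d} x _ = mk⇔ ceil≤x⇒n≤x*a n≤x*a⇒ceil≤x
  where
  open ℕ.≤-Reasoning
  ceil≤x⇒n≤x*a : (n + d) / suc d ≤ x → n ≤ x * suc d
  ceil≤x⇒n≤x*a h = ℕ.+-cancelʳ-≤ d n (x * suc d) (begin
    n + d                                       ≡⟨ ℕ.m≡m%n+[m/n]*n (n + d) (suc d) ⟩
    (n + d) % suc d + (n + d) / suc d * suc d   ≤⟨ ℕ.+-mono-≤ (ℕ.≤-pred (ℕ.m%n<n (n + d) (suc d))) (ℕ.*-monoˡ-≤ (suc d) h) ⟩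
    d + x * suc d                               ≡⟨ ℕ.+-comm d (x * suc d) ⟩
    x * suc d + d                               ∎)
  n≤x*a⇒ceil≤x : n ≤ x * suc d → (n + d) / suc d ≤ x
  n≤x*a⇒ceil≤x h = ℕ.≤-pred (ℕ.m<n*o⇒m/o<n (s≤s (begin
    n + d          ≤⟨ ℕ.+-monoˡ-≤ d h ⟩
    x * suc d + d  ≡⟨ ℕ.+-comm (x * suc d) d ⟩
    d + x * suc d  ∎)))

ratioOK⇒≤head : ∀ {n} (a τ : Vec ℕ (suc n)) → (∀ i → 1 ≤ lookup a i) →
                (∀ i i′ → i Fin.≤ i′ → lookup a i′ ≤ lookup a i) → T (ratioOK a τ) → All (_≤ head τ) τ
ratioOK⇒≤head (_ ∷ [])     (x ∷ [])     _   _        _  = ℕ.≤-refl ∷ []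
ratioOK⇒≤head (a ∷ b ∷ as) (x ∷ y ∷ xs) pos antitone ok =
  ℕ.≤-refl ∷ All.map (λ z≤y → ℕ.≤-trans z≤y y≤x)
                     (ratioOK⇒≤head (b ∷ as) (y ∷ xs) (pos ∘ Fin.suc)
                                    (λ i i′ → antitone (Fin.suc i) (Fin.suc i′) ∘ s≤s) (proj₂ (T-split ok)))
  where
  instance
    a≢0 : NonZero a
    a≢0 = >-nonZero (pos Fin.zero)
  open ℕ.≤-Reasoning
  y≤x : y ≤ x
  y≤x = ℕ.*-cancelʳ-≤ y x a (begin
    y * a  ≤⟨ ℕ.≤ᵇ⇒≤ _ _ (proj₁ (T-split ok)) ⟩
    x * b  ≤⟨ ℕ.*-monoʳ-≤ x (antitone Fin.zero (Fin.suc Fin.zero) z≤n) ⟩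
    x * a  ∎)

sumAlt-≡ : ∀ {n} c d (v : Vec ℕ n) → sumAlt c d v ≡ c ℤ.* + sumOdd v ℤ.+ d ℤ.* + sumEven v
sumAlt-≡ c d []       = solve 2 (λ c d → con (+ 0) := c :* con (+ 0) :+ d :* con (+ 0)) refl c d
  where open +-*-Solver
sumAlt-≡ c d (x ∷ xs) = begin
  c ℤ.* + x ℤ.+ sumAlt d c xs                                      ≡⟨ cong (ℤ._+_ (c ℤ.* + x)) (sumAlt-≡ d c xs) ⟩
  c ℤ.* + x ℤ.+ (d ℤ.* + sumOdd xs ℤ.+ c ℤ.* + sumEven xs)         ≡⟨ regroup c d (+ x) (+ sumOdd xs) (+ sumEven xs) ⟩
  c ℤ.* (+ x ℤ.+ + sumEven xs) ℤ.+ d ℤ.* + sumOdd xs               ≡⟨ cong (λ z → c ℤ.* z ℤ.+ d ℤ.* + sumOdd xs) (pos-+ x (sumEven xs)) ⟨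
  c ℤ.* + (x + sumEven xs) ℤ.+ d ℤ.* + sumOdd xs                   ∎
  where
  open ≡-Reasoning
  open +-*-Solver
  regroup : ∀ c d x o e → c ℤ.* x ℤ.+ (d ℤ.* o ℤ.+ c ℤ.* e) ≡ c ℤ.* (x ℤ.+ e) ℤ.+ d ℤ.* o
  regroup = solve 5 (λ c d x o e → c :* x :+ (d :* o :+ c :* e) := c :* (x :+ e) :+ d :* o) refl

+[l*e]+c≡p⇒e≤∣p-c∣ : ∀ {l} e (c p : ℤ) → 0 < l → + (l * e) ℤ.+ c ≡ p → e ≤ ℤ.∣ p ℤ.- c ∣
+[l*e]+c≡p⇒e≤∣p-c∣ {suc l} e c p _ eq = subst (λ z → e ≤ ℤ.∣ z ∣) p-c≡l*e (ℕ.m≤n*m e (suc l))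
  where
  cancel : ∀ x c → x ≡ (x ℤ.+ c) ℤ.- c
  cancel = solve 2 (λ x c → x := (x :+ c) :- c) refl
    where open +-*-Solver
  p-c≡l*e : + (suc l * e) ≡ p ℤ.- c
  p-c≡l*e = trans (cancel (+ (suc l * e)) c) (cong (ℤ._- c) eq)

+[m+n]-+m≡+n : ∀ m n → + (m + n) ℤ.- + m ≡ + n
+[m+n]-+m≡+n m n = trans ([+m]-[+n]≡m⊖n (m + n) m) (trans (⊖-≥ (ℕ.m≤m+n m n)) (cong +_ (ℕ.m+n∸m≡n m n)))

module Tails (a₁ a₂ : ℕ) {m} (as : Vec ℕ m)
  (pos : ∀ i → 1 ≤ lookup (a₂ ∷ as) i)
  (antitone : ∀ i i′ → i Fin.≤ i′ → lookup (a₂ ∷ as) i′ ≤ lookup (a₂ ∷ as) i) where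

  leastHead : Vec ℕ (suc m) → ℕ
  leastHead τ = ceilDiv (a₁ * head τ) a₂

  leastExponent : Vec ℕ (suc m) → ℕ
  leastExponent τ = leastHead τ + sumEven τ

  tailOK : ℕ → Vec ℕ (suc m) → Bool
  tailOK q τ = ratioOK (a₂ ∷ as) τ ∧ (sumOdd τ ≡ᵇ q)

  admissible : ℕ → ℕ → Vec ℕ (suc (suc m)) → Bool
  admissible A q lam = ratioOK (a₁ ∷ a₂ ∷ as) lam ∧ (sumOdd lam ≡ᵇ A) ∧ (sumEven lam ≡ᵇ q)

  tailOK⇒≤ : ∀ q τ → T (tailOK q τ) → All (_≤ q) τ
  tailOK⇒≤ q τ@(t ∷ ts) h = All.map (λ z≤t → ℕ.≤-trans z≤t t≤q) (ratioOK⇒≤head (a₂ ∷ as) τ pos antitone ok)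
    where
    ok : T (ratioOK (a₂ ∷ as) τ)
    ok = proj₁ (T-split h)
    t≤q : t ≤ q
    t≤q = subst (t ≤_) (ℕ.≡ᵇ⇒≡ _ _ (proj₂ (T-split {ratioOK (a₂ ∷ as) τ} h))) (ℕ.m≤m+n t (sumEven ts))

  ratioStep-≡ : ∀ x t → (t * a₁ ≤ᵇ x * a₂) ≡ (ceilDiv (a₁ * t) a₂ ≤ᵇ x)
  ratioStep-≡ x t = T-injective (ℕ.≤⇒≤ᵇ ∘ from ∘ subst (_≤ x * a₂) (ℕ.*-comm t a₁) ∘ ℕ.≤ᵇ⇒≤ _ _)
                                (ℕ.≤⇒≤ᵇ ∘ subst (_≤ x * a₂) (ℕ.*-comm a₁ t) ∘ to ∘ ℕ.≤ᵇ⇒≤ _ _)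
    where open Equivalence (ceilDiv-≤⇔ (a₁ * t) x (pos Fin.zero))

  admissible-∷ : ∀ A q x τ → admissible A q (x ∷ τ) ≡ tailOK q τ ∧ ((leastHead τ ≤ᵇ x) ∧ (x + sumEven τ ≡ᵇ A))
  admissible-∷ A q x τ@(t ∷ _) = begin
    ((t * a₁ ≤ᵇ x * a₂) ∧ ratioOK (a₂ ∷ as) τ) ∧ ((x + sumEven τ ≡ᵇ A) ∧ (sumOdd τ ≡ᵇ q))
      ≡⟨ ∧-interchange (t * a₁ ≤ᵇ x * a₂) (ratioOK (a₂ ∷ as) τ) (x + sumEven τ ≡ᵇ A) (sumOdd τ ≡ᵇ q) ⟩
    ((t * a₁ ≤ᵇ x * a₂) ∧ (x + sumEven τ ≡ᵇ A)) ∧ tailOK q τ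
      ≡⟨ ∧-comm ((t * a₁ ≤ᵇ x * a₂) ∧ (x + sumEven τ ≡ᵇ A)) (tailOK q τ) ⟩
    tailOK q τ ∧ ((t * a₁ ≤ᵇ x * a₂) ∧ (x + sumEven τ ≡ᵇ A))
      ≡⟨ cong (λ z → tailOK q τ ∧ (z ∧ (x + sumEven τ ≡ᵇ A))) (ratioStep-≡ x t) ⟩
    tailOK q τ ∧ ((leastHead τ ≤ᵇ x) ∧ (x + sumEven τ ≡ᵇ A))
      ∎
    where open ≡-Reasoning

  gCoeff-≡ : ∀ A q → gCoeff (a₁ ∷ a₂ ∷ as) A q ≡ countB (λ τ → tailOK q τ ∧ (leastExponent τ ≤ᵇ A)) (vecsUpTo (suc m) q)
  gCoeff-≡ A q = begin
    gCoeff (a₁ ∷ a₂ ∷ as) A q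
      ≡⟨ countB-vecsUpTo-suc (admissible A q) (A + q) ⟩
    sumBelow (suc (A + q)) (λ x → countB (admissible A q ∘ (x ∷_)) (vecsUpTo (suc m) (A + q)))
      ≡⟨ sumBelow-countB (suc (A + q)) (λ x τ → admissible A q (x ∷ τ)) below-A (vecsUpTo (suc m) (A + q)) heads ⟩
    countB below-A (vecsUpTo (suc m) (A + q))
      ≡⟨ countB-vecsUpTo-≤ (suc m) below-A (ℕ.m≤n+m q A) (λ τ → tailOK⇒≤ q τ ∘ proj₁ ∘ T-split) ⟩
    countB below-A (vecsUpTo (suc m) q)
      ∎
    where
    open ≡-Reasoning
    below-A : Vec ℕ (suc m) → Bool
    below-A τ = tailOK q τ ∧ (leastExponent τ ≤ᵇ A)
    heads : ∀ τ → sumBelow (suc (A + q)) (λ x → ind (admissible A q (x ∷ τ)))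
                ≡ ind (tailOK q τ ∧ (leastExponent τ ≤ᵇ A))
    heads τ = trans (sumBelow-cong (suc (A + q)) (λ x → cong ind (admissible-∷ A q x τ)))
                    (sumBelow-[c≤x∧x+s≡A] (suc (A + q)) (leastHead τ) (sumEven τ) A (s≤s (ℕ.m≤m+n A q)) (tailOK q τ))

  hCoeff-≡ : ∀ A q → hCoeff (a₁ ∷ a₂ ∷ as) A q ≡ + countB (λ τ → tailOK q τ ∧ (leastExponent τ ≡ᵇ A)) (vecsUpTo (suc m) q)
  hCoeff-≡ zero    q = cong +_ (trans (gCoeff-≡ 0 q) (countB-cong (vecsUpTo (suc m) q)
                                   (λ τ → cong (tailOK q τ ∧_) (≤ᵇ0≡≡ᵇ0 (leastExponent τ)))))
  hCoeff-≡ (suc A) q =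
    trans (cong₂ (λ u v → + u ℤ.- + v) (trans (gCoeff-≡ (suc A) q) (countB-+ {Q = below-A} tails split)) (gCoeff-≡ A q))
          (+[m+n]-+m≡+n (countB below-A tails) _)
    where
    tails : List (Vec ℕ (suc m))
    tails = vecsUpTo (suc m) q
    below-A : Vec ℕ (suc m) → Bool
    below-A τ = tailOK q τ ∧ (leastExponent τ ≤ᵇ A)
    split : ∀ τ → ind (tailOK q τ ∧ (leastExponent τ ≤ᵇ suc A))
                ≡ ind (below-A τ) + ind (tailOK q τ ∧ (leastExponent τ ≡ᵇ suc A))
    split τ with tailOK q τ
    ... | true  = ind-≤ᵇ-suc (leastExponent τ) A
    ... | false = refl

  exponent-≡ : ∀ l j τ → + (l * leastExponent τ) ℤ.+ (j ℤ.- + 1) ℤ.* + sumOdd τ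
                       ≡ lambda1 a₁ (a₂ ∷ as) l j τ ℤ.+ + sumEven τ
  exponent-≡ l j τ@(_ ∷ _) = begin
    + (l * (h + e)) ℤ.+ J ℤ.* + o
      ≡⟨ cong (ℤ._+ J ℤ.* + o) (trans (pos-* l (h + e)) (cong (ℤ._*_ (+ l)) (pos-+ h e))) ⟩
    + l ℤ.* (+ h ℤ.+ + e) ℤ.+ J ℤ.* + o
      ≡⟨ regroup (+ l) (+ h) (+ e) J (+ o) ⟩
    + l ℤ.* + h ℤ.+ (J ℤ.* + o ℤ.+ (+ l ℤ.- + 1) ℤ.* + e) ℤ.+ + e
      ≡⟨ cong₂ (λ u v → u ℤ.+ v ℤ.+ + e) (pos-* l h) (sumAlt-≡ J (+ l ℤ.- + 1) τ) ⟨
    + (l * h) ℤ.+ sumAlt J (+ l ℤ.- + 1) τ ℤ.+ + e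
      ∎
    where
    open ≡-Reasoning
    h e o : ℕ
    h = leastHead τ
    e = sumEven τ
    o = sumOdd τ
    J : ℤ
    J = j ℤ.- + 1
    regroup : ∀ l h e J o → l ℤ.* (h ℤ.+ e) ℤ.+ J ℤ.* o ≡ l ℤ.* h ℤ.+ (J ℤ.* o ℤ.+ (l ℤ.- + 1) ℤ.* e) ℤ.+ e
    regroup = solve 5 (λ l h e J o → l :* (h :+ e) :+ J :* o := l :* h :+ (J :* o :+ (l :- con (+ 1)) :* e) :+ e) refl
      where open +-*-Solver

  lhsCoeff≡rhsCoeff : ∀ l j p q → 0 < l → lhsCoeff (a₁ ∷ a₂ ∷ as) l j p q ≡ + rhsCoeff (a₁ ∷ a₂ ∷ as) l j p q
  lhsCoeff≡rhsCoeff l j p q l>0 = begin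
    lhsCoeff (a₁ ∷ a₂ ∷ as) l j p q
      ≡⟨ sumTo-cong D (λ A → cong (λ h → if cnd A then h else + 0) (hCoeff-≡ A q)) ⟩
    sumTo D (λ A → if cnd A then + countB (λ τ → tailOK q τ ∧ (leastExponent τ ≡ᵇ A)) tails else + 0)
      ≡⟨ sumTo-fibres leastExponent cnd D cnd⇒≤D (tailOK q) tails ⟩
    + countB (λ τ → tailOK q τ ∧ cnd (leastExponent τ)) tails
      ≡⟨ cong +_ (countB-cong tails (λ τ → [r∧o]∧c≡r∧[c′∧o] (ratioOK (a₂ ∷ as) τ) _ (cnd≡ τ ∘ ℕ.≡ᵇ⇒≡ _ _))) ⟩
    + rhsCoeff (a₁ ∷ a₂ ∷ as) l j p q
      ∎
    where
    open ≡-Reasoning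
    tails : List (Vec ℕ (suc m))
    tails = vecsUpTo (suc m) q
    J : ℤ
    J = j ℤ.- + 1
    D : ℕ
    D = ℤ.∣ p ℤ.- J ℤ.* + q ∣
    cnd : ℕ → Bool
    cnd A = (+ (l * A) ℤ.+ J ℤ.* + q) ==ℤ p
    cnd⇒≤D : ∀ A → T (cnd A) → A ≤ D
    cnd⇒≤D A h = +[l*e]+c≡p⇒e≤∣p-c∣ A (J ℤ.* + q) p l>0 (toWitness h)
    cnd≡ : ∀ τ → sumOdd τ ≡ q → cnd (leastExponent τ) ≡ ((lambda1 a₁ (a₂ ∷ as) l j τ ℤ.+ + sumEven τ) ==ℤ p)
    cnd≡ τ refl = cong (_==ℤ p) (exponent-≡ l j τ)

theorem5 : (k : ℕ) → 2 ≤ k → (a : Vec ℕ k)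
    → (∀ (i : Fin k) → 1 ≤ lookup a i)
    → (∀ (i i′ : Fin k) → i Fin.≤ i′ → lookup a i′ ≤ lookup a i)
    → (l : ℕ) → 0 < l → (j : ℤ) → (+ 2 ℤ.- + l) ℤ.≤ j
    → (p : ℤ) → (q : ℕ)
    → lhsCoeff a l j p q ≡ + rhsCoeff a l j p q
theorem5 (suc zero) (s≤s ()) _ _ _ _ _ _ _ _ _
theorem5 (suc (suc m)) _ (a₁ ∷ a₂ ∷ as) pos antitone l l>0 j _ p q = lhsCoeff≡rhsCoeff l j p q l>0
  where open Tails a₁ a₂ as (pos ∘ Fin.suc) (λ i i′ → antitone (Fin.suc i) (Fin.suc i′) ∘ s≤s)
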